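{- For every $n$, $T(n,\mathcal{F}(3),2)=\max\{T(n,\mathcal{F}(3),1),\ m(n,3,K_4-e)+2\}$.
   Context: A 3-graph is a pair $(X,\mathcal{A})$ with $X$ a finite vertex set and $\mathcal{A}$ a set of 3-subsets of $X$ (edges); its order is $|X|$. $\mathcal{F}(3)=\{\Lambda(3,2)\}$, where $\Lambda(3,2)$ is the 3-graph with two edges meeting in exactly 2 points. $T(n,\mathcal{F}(3),1)$ is the maximum number of edges of a 3-graph of order $n$ containing no pair of distinct edges meeting in two points; $T(n,\mathcal{F}(3),2)$ is the maximum number of edges of a 3-graph of order $n$ containing at most one pair of distinct edges meeting in two points. A 2-$(n,3,1)$ packing is a 3-graph of order $n$ in which every 2-subset lies in at most one edge (block); its leave is the graph on the vertex set whose edges are the 2-subsets contained in no block. $m(n,3,G)$ is the maximum number of blocks of a 2-$(n,3,1)$ packing whose leave contains a subgraph isomorphic to the graph $G$. $K_4-e$ is $K_4$ minus one edge. -}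

module Defs where

open import Data.Nat using (ℕ; _≤_; _+_; _⊔_)
open import Data.Fin using (Fin; _<_)
open import Data.Product using (Σ; ∃; _×_; _,_)
open import Data.Sum using (_⊎_)
open import Data.List using (List; length; lookup)
open import Data.List.Relation.Unary.Unique.Propositional using (Unique)
open import Data.List.Membership.Propositional using (_∈_)
open import Relation.Nullary using (¬_)
open import Relation.Binary.PropositionalEquality using (_≡_; _≢_)

-- A 3-subset of the vertex set Fin n, represented as a strictly increasing triple.
record Triple (n : ℕ) : Set where
  constructor triple
  field
    a b c : Fin n
    a<b : a < b
    b<c : b < c
open Triple public

_∈ₜ_ : ∀ {n} → Fin n → Triple n → Set
x ∈ₜ t = x ≡ a t ⊎ x ≡ b t ⊎ x ≡ c t

record ThreeGraph (n : ℕ) : Set where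
  constructor mk3G
  field
    edges  : List (Triple n)
    unique : Unique edges
open ThreeGraph public

numEdges : ∀ {n} → ThreeGraph n → ℕ
numEdges H = length (edges H)

-- two 3-subsets share (at least) two distinct points;
-- for distinct 3-subsets this means they meet in exactly 2 points.
Share2 : ∀ {n} → Triple n → Triple n → Set
Share2 {n} e f = Σ (Fin n) λ x → Σ (Fin n) λ y →
  x ≢ y × x ∈ₜ e × y ∈ₜ e × x ∈ₜ f × y ∈ₜ f

-- ordered index pair (i < j) of distinct edges meeting in exactly two points,
-- i.e. an (unordered) pair of distinct edges forming a copy of Λ(3,2)
BadPair : ∀ {n} (H : ThreeGraph n) → Fin (numEdges H) → Fin (numEdges H) → Set
BadPair H i j = i < j × Share2 (lookup (edges H) i) (lookup (edges H) j)

Free1 : ∀ {n} → ThreeGraph n → Set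
Free1 H = ∀ i j → ¬ BadPair H i j

Free2 : ∀ {n} → ThreeGraph n → Set
Free2 H = ∀ i j k l → BadPair H i j → BadPair H k l → i ≡ k × j ≡ l

IsPacking : ∀ {n} → ThreeGraph n → Set
IsPacking {n} H = ∀ (x y : Fin n) → x ≢ y → ∀ e f → e ∈ edges H → f ∈ edges H →
  x ∈ₜ e → y ∈ₜ e → x ∈ₜ f → y ∈ₜ f → e ≡ f

LeaveEdge : ∀ {n} → ThreeGraph n → Fin n → Fin n → Set
LeaveEdge H x y = x ≢ y × (∀ e → e ∈ edges H → ¬ (x ∈ₜ e × y ∈ₜ e))

LeaveHasK4-e : ∀ {n} → ThreeGraph n → Set
LeaveHasK4-e {n} H = Σ (Fin n) λ v0 → Σ (Fin n) λ v1 → Σ (Fin n) λ v2 → Σ (Fin n) λ v3 →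
  v2 ≢ v3 ×
  LeaveEdge H v0 v1 × LeaveEdge H v0 v2 × LeaveEdge H v0 v3 ×
  LeaveEdge H v1 v2 × LeaveEdge H v1 v3

IsMax : (ℕ → Set) → ℕ → Set
IsMax P k = P k × (∀ j → P j → j ≤ k)

Achieves1 : ℕ → ℕ → Set
Achieves1 n k = Σ (ThreeGraph n) λ H → Free1 H × numEdges H ≡ k

Achieves2 : ℕ → ℕ → Set
Achieves2 n k = Σ (ThreeGraph n) λ H → Free2 H × numEdges H ≡ k

AchievesM : ℕ → ℕ → Set
AchievesM n k = Σ (ThreeGraph n) λ H → IsPacking H × LeaveHasK4-e H × numEdges H ≡ k

IsT1 : ℕ → ℕ → Set
IsT1 n t = IsMax (Achieves1 n) t

IsT2 : ℕ → ℕ → Set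
IsT2 n t = IsMax (Achieves2 n) t

IsM : ℕ → ℕ → Set
IsM n t = IsMax (AchievesM n) t

-- The set of edge counts of 3-graphs with at most one Λ(3,2) is the union of
-- the edge counts of Λ(3,2)-free 3-graphs and the numbers k + 2 with k the
-- number of blocks of a packing whose leave contains K4-e:
--   * a Λ(3,2)-free 3-graph trivially has at most one bad pair;
--   * if the leave of a packing contains K4-e on v0 v1 v2 v3 (missing v2v3),
--     adding the blocks {v0,v1,v2} and {v0,v1,v3} creates exactly one bad pair;
--   * conversely, deleting both edges of the unique bad pair of a 3-graph
--     leaves a packing whose leave contains the K4-e spanned by those edges.
-- The corollary then follows from two facts about maxima of sets of naturals.
module Submission where

open import Defs
open import Level using (0ℓ)
open import Data.Nat using (ℕ; suc; _+_; _⊔_; s≤s)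
import Data.Nat.Properties as ℕ
open import Data.Fin using (Fin; _<_; _<?_) renaming (zero to fzero; suc to fsuc)
import Data.Fin.Properties as Fin
open import Data.Product using (Σ; ∃; _×_; _,_; proj₁; proj₂; map₂)
open import Data.Sum using (_⊎_; inj₁; inj₂; [_,_]′)
import Data.Sum as Sum
open import Data.Empty using (⊥-elim)
open import Data.List using (List; _∷_; length; lookup; filter)
open import Data.List.Properties using (filter-all; filter-accept; filter-reject)
open import Data.List.Relation.Unary.All as All using (All; _∷_)
open import Data.List.Relation.Unary.AllPairs using (_∷_)
open import Data.List.Relation.Unary.Any using (here; there; index)
open import Data.List.Relation.Unary.Any.Properties using (lookup-index)
open import Data.List.Relation.Unary.Unique.Propositional using (Unique)
import Data.List.Relation.Unary.Unique.Propositional.Properties as Unique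
open import Data.List.Membership.Propositional using (_∈_)
open import Data.List.Membership.Propositional.Properties using (∈-lookup; ∈-filter⁻; ∈-filter⁺)
open import Function using (id; _∘_)
open import Relation.Nullary using (¬_; Dec; yes; no)
open import Relation.Nullary.Decidable using (¬?; map′; _×-dec_; _⊎-dec_)
open import Relation.Unary using (Pred; _⊆_; _∪_)
open import Relation.Binary.Definitions using (DecidableEquality; tri<; tri≈; tri>)
open import Relation.Binary.PropositionalEquality
  using (_≡_; _≢_; refl; sym; trans; cong; cong₂; subst₂; ≢-sym; module ≡-Reasoning)

-- a triple is determined by its three points (the order proofs are irrelevant)
triple-ext : ∀ {n} {t s : Triple n} → a t ≡ a s → b t ≡ b s → c t ≡ c s → t ≡ s
triple-ext {t = triple _ _ _ p q} {triple _ _ _ p′ q′} refl refl refl =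
  cong₂ (triple _ _ _) (Fin.<-irrelevant p p′) (Fin.<-irrelevant q q′)

a<c : ∀ {n} (t : Triple n) → a t < c t
a<c t = Fin.<-trans (a<b t) (b<c t)

not-below-a : ∀ {n} (s : Triple n) {x} → x ∈ₜ s → ¬ (x < a s)
not-below-a s (inj₁ refl) = Fin.<-irrefl refl
not-below-a s (inj₂ (inj₁ refl)) = Fin.<-asym (a<b s)
not-below-a s (inj₂ (inj₂ refl)) = Fin.<-asym (a<c s)

not-above-c : ∀ {n} (s : Triple n) {x} → x ∈ₜ s → ¬ (c s < x)
not-above-c s (inj₁ refl) = Fin.<-asym (a<c s)
not-above-c s (inj₂ (inj₁ refl)) = Fin.<-asym (b<c s)
not-above-c s (inj₂ (inj₂ refl)) = Fin.<-irrefl refl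

below-b : ∀ {n} (s : Triple n) {x} → x ∈ₜ s → x < b s → x ≡ a s
below-b s (inj₁ x≡a) _ = x≡a
below-b s (inj₂ (inj₁ refl)) b<b = ⊥-elim (Fin.<-irrefl refl b<b)
below-b s (inj₂ (inj₂ refl)) c<b = ⊥-elim (Fin.<-asym (b<c s) c<b)

above-b : ∀ {n} (s : Triple n) {x} → x ∈ₜ s → b s < x → x ≡ c s
above-b s (inj₁ refl) b<a = ⊥-elim (Fin.<-asym (a<b s) b<a)
above-b s (inj₂ (inj₁ refl)) b<b = ⊥-elim (Fin.<-irrefl refl b<b)
above-b s (inj₂ (inj₂ x≡c)) _ = x≡c

increasing-points : ∀ {n} (s : Triple n) {x y z} → x < y → y < z →
  x ∈ₜ s → y ∈ₜ s → z ∈ₜ s → x ≡ a s × y ≡ b s × z ≡ c s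
increasing-points s x<a _ x∈ (inj₁ refl) _ = ⊥-elim (not-below-a s x∈ x<a)
increasing-points s x<b b<z x∈ (inj₂ (inj₁ refl)) z∈ = below-b s x∈ x<b , refl , above-b s z∈ b<z
increasing-points s _ c<z _ (inj₂ (inj₂ refl)) z∈ = ⊥-elim (not-above-c s z∈ c<z)

⊆⇒≡ : ∀ {n} (t s : Triple n) → a t ∈ₜ s → b t ∈ₜ s → c t ∈ₜ s → t ≡ s
⊆⇒≡ t s a∈ b∈ c∈ with increasing-points s (a<b t) (b<c t) a∈ b∈ c∈
... | a≡ , b≡ , c≡ = triple-ext a≡ b≡ c≡

third : ∀ {n} (e : Triple n) {x y} → x ≢ y → x ∈ₜ e → y ∈ₜ e →
  Σ (Fin n) λ z → z ∈ₜ e × z ≢ x × z ≢ y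
third e x≢x (inj₁ refl) (inj₁ refl) = ⊥-elim (x≢x refl)
third e _ (inj₁ refl) (inj₂ (inj₁ refl)) =
  c e , inj₂ (inj₂ refl) , ≢-sym (Fin.<⇒≢ (a<c e)) , ≢-sym (Fin.<⇒≢ (b<c e))
third e _ (inj₁ refl) (inj₂ (inj₂ refl)) =
  b e , inj₂ (inj₁ refl) , ≢-sym (Fin.<⇒≢ (a<b e)) , Fin.<⇒≢ (b<c e)
third e _ (inj₂ (inj₁ refl)) (inj₁ refl) =
  c e , inj₂ (inj₂ refl) , ≢-sym (Fin.<⇒≢ (b<c e)) , ≢-sym (Fin.<⇒≢ (a<c e))
third e x≢x (inj₂ (inj₁ refl)) (inj₂ (inj₁ refl)) = ⊥-elim (x≢x refl)
third e _ (inj₂ (inj₁ refl)) (inj₂ (inj₂ refl)) =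
  a e , inj₁ refl , Fin.<⇒≢ (a<b e) , Fin.<⇒≢ (a<c e)
third e _ (inj₂ (inj₂ refl)) (inj₁ refl) =
  b e , inj₂ (inj₁ refl) , Fin.<⇒≢ (b<c e) , ≢-sym (Fin.<⇒≢ (a<b e))
third e _ (inj₂ (inj₂ refl)) (inj₂ (inj₁ refl)) =
  a e , inj₁ refl , Fin.<⇒≢ (a<c e) , Fin.<⇒≢ (a<b e)
third e x≢x (inj₂ (inj₂ refl)) (inj₂ (inj₂ refl)) = ⊥-elim (x≢x refl)

OneOf : ∀ {n} → Fin n → Fin n → Fin n → Fin n → Set
OneOf u x y z = u ≡ x ⊎ u ≡ y ⊎ u ≡ z

record Spans {n} (t : Triple n) (x y z : Fin n) : Set where
  constructor spans
  field
    contains : x ∈ₜ t × y ∈ₜ t × z ∈ₜ t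
    only     : ∀ {u} → u ∈ₜ t → OneOf u x y z

spans-triple : ∀ {n} {x y z : Fin n} (x<y : x < y) (y<z : y < z) →
  Spans (triple x y z x<y y<z) x y z
spans-triple _ _ = spans (inj₁ refl , inj₂ (inj₁ refl) , inj₂ (inj₂ refl)) id

spans-swap₁₂ : ∀ {n} {t : Triple n} {x y z} → Spans t x y z → Spans t y x z
spans-swap₁₂ (spans (x∈ , y∈ , z∈) only) = spans (y∈ , x∈ , z∈) λ u∈ → swap (only u∈)
  where
  swap : ∀ {u x y z} → OneOf u x y z → OneOf u y x z
  swap = [ inj₂ ∘ inj₁ , [ inj₁ , inj₂ ∘ inj₂ ]′ ]′

spans-swap₂₃ : ∀ {n} {t : Triple n} {x y z} → Spans t x y z → Spans t x z y
spans-swap₂₃ (spans (x∈ , y∈ , z∈) only) = spans (x∈ , z∈ , y∈) λ u∈ → Sum.map₂ Sum.swap (only u∈)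

span-insert : ∀ {n} {x y z : Fin n} → x < y → z ≢ x → z ≢ y → Σ (Triple n) λ t → Spans t x y z
span-insert {x = x} {y} {z} x<y z≢x z≢y with Fin.<-cmp z x
... | tri< z<x _ _ = triple z x y z<x x<y , spans-swap₂₃ (spans-swap₁₂ (spans-triple z<x x<y))
... | tri≈ _ z≡x _ = ⊥-elim (z≢x z≡x)
... | tri> _ _ x<z with Fin.<-cmp z y
...   | tri< z<y _ _ = triple x z y x<z z<y , spans-swap₂₃ (spans-triple x<z z<y)
...   | tri≈ _ z≡y _ = ⊥-elim (z≢y z≡y)
...   | tri> _ _ y<z = triple x y z x<y y<z , spans-triple x<y y<z

span : ∀ {n} {x y z : Fin n} → x ≢ y → x ≢ z → y ≢ z → Σ (Triple n) λ t → Spans t x y z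
span {x = x} {y} x≢y x≢z y≢z with Fin.<-cmp x y
... | tri< x<y _ _ = span-insert x<y (≢-sym x≢z) (≢-sym y≢z)
... | tri≈ _ x≡y _ = ⊥-elim (x≢y x≡y)
... | tri> _ _ y<x = map₂ spans-swap₁₂ (span-insert y<x (≢-sym y≢z) (≢-sym x≢z))

spans-unique : ∀ {n} {t : Triple n} {x y z} → Spans t x y z →
  (s : Triple n) → x ∈ₜ s → y ∈ₜ s → z ∈ₜ s → t ≡ s
spans-unique {t = t} {x} {y} {z} (spans _ only) s x∈ y∈ z∈ =
  ⊆⇒≡ t s (inside (only (inj₁ refl))) (inside (only (inj₂ (inj₁ refl)))) (inside (only (inj₂ (inj₂ refl))))
  where
  inside : ∀ {u} → OneOf u x y z → u ∈ₜ s
  inside (inj₁ refl) = x∈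
  inside (inj₂ (inj₁ refl)) = y∈
  inside (inj₂ (inj₂ refl)) = z∈

three-points-determine : ∀ {n} (e f : Triple n) {x y z} → x ≢ y → x ≢ z → y ≢ z →
  x ∈ₜ e → y ∈ₜ e → z ∈ₜ e → x ∈ₜ f → y ∈ₜ f → z ∈ₜ f → e ≡ f
three-points-determine e f x≢y x≢z y≢z xe ye ze xf yf zf with span x≢y x≢z y≢z
... | _ , xyz = trans (sym (spans-unique xyz e xe ye ze)) (spans-unique xyz f xf yf zf)

_≟ₜ_ : ∀ {n} → DecidableEquality (Triple n)
t ≟ₜ s = map′ (λ (p , q , r) → triple-ext p q r) (λ { refl → refl , refl , refl })
  (a t Fin.≟ a s ×-dec b t Fin.≟ b s ×-dec c t Fin.≟ c s)

_∈ₜ?_ : ∀ {n} (u : Fin n) (t : Triple n) → Dec (u ∈ₜ t)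
u ∈ₜ? t = (u Fin.≟ a t) ⊎-dec (u Fin.≟ b t) ⊎-dec (u Fin.≟ c t)

share2? : ∀ {n} (e f : Triple n) → Dec (Share2 e f)
share2? e f = Fin.any? λ x → Fin.any? λ y →
  ¬? (x Fin.≟ y) ×-dec x ∈ₜ? e ×-dec y ∈ₜ? e ×-dec x ∈ₜ? f ×-dec y ∈ₜ? f

HasBadPair : ∀ {n} → ThreeGraph n → Set
HasBadPair H = Σ (Fin (numEdges H)) λ i → Σ (Fin (numEdges H)) λ j → BadPair H i j

hasBadPair? : ∀ {n} (H : ThreeGraph n) → Dec (HasBadPair H)
hasBadPair? H = Fin.any? λ i → Fin.any? λ j →
  (i <? j) ×-dec share2? (lookup (edges H) i) (lookup (edges H) j)

share2-sym : ∀ {n} {e f : Triple n} → Share2 e f → Share2 f e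
share2-sym (x , y , x≢y , xe , ye , xf , yf) = x , y , x≢y , xf , yf , xe , ye

lookup-injective : ∀ {A : Set} {xs : List A} → Unique xs → ∀ i j → lookup xs i ≡ lookup xs j → i ≡ j
lookup-injective (_ ∷ _) fzero fzero _ = refl
lookup-injective (x∉ ∷ _) fzero (fsuc j) eq = ⊥-elim (All.lookup x∉ (∈-lookup j) eq)
lookup-injective (x∉ ∷ _) (fsuc i) fzero eq = ⊥-elim (All.lookup x∉ (∈-lookup i) (sym eq))
lookup-injective (_ ∷ u) (fsuc i) (fsuc j) eq = cong fsuc (lookup-injective u i j eq)

ordered-positions : ∀ {A : Set} {xs : List A} {g h : A} → g ∈ xs → h ∈ xs → g ≢ h →
  Σ (Fin (length xs)) λ k → Σ (Fin (length xs)) λ l → k < l ×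
    ((lookup xs k ≡ g × lookup xs l ≡ h) ⊎ (lookup xs k ≡ h × lookup xs l ≡ g))
ordered-positions {xs = xs} g∈ h∈ g≢h with Fin.<-cmp (index g∈) (index h∈)
... | tri< k<l _ _ = index g∈ , index h∈ , k<l , inj₁ (sym (lookup-index g∈) , sym (lookup-index h∈))
... | tri≈ _ k≡l _ =
  ⊥-elim (g≢h (trans (lookup-index g∈) (trans (cong (lookup xs) k≡l) (sym (lookup-index h∈)))))
... | tri> _ _ l<k = index h∈ , index g∈ , l<k , inj₂ (sym (lookup-index h∈) , sym (lookup-index g∈))

module Deletion {A : Set} (_≟_ : DecidableEquality A) where

  infixl 5 _without_
  _without_ : List A → A → List A
  xs without v = filter (λ g → ¬? (g ≟ v)) xs

  without-⊆ : ∀ xs v {g} → g ∈ xs without v → g ∈ xs × g ≢ v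
  without-⊆ xs v = ∈-filter⁻ (λ g → ¬? (g ≟ v)) {xs = xs}

  without-keeps : ∀ {xs} v {g} → g ∈ xs → g ≢ v → g ∈ xs without v
  without-keeps {xs} v = ∈-filter⁺ (λ g → ¬? (g ≟ v)) {xs = xs}

  without-unique : ∀ {xs} v → Unique xs → Unique (xs without v)
  without-unique v = Unique.filter⁺ (λ g → ¬? (g ≟ v))

  length-without : ∀ {xs} v → Unique xs → v ∈ xs → length xs ≡ suc (length (xs without v))
  length-without {x ∷ xs} _ (x∉ ∷ _) (here refl)
    rewrite filter-reject (λ g → ¬? (g ≟ x)) {x} {xs} (λ x≢x → x≢x refl)
          | filter-all (λ g → ¬? (g ≟ x)) (All.map (λ x≢g g≡x → x≢g (sym g≡x)) x∉) = refl
  length-without {x ∷ xs} v (x∉ ∷ u) (there v∈)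
    rewrite filter-accept (λ g → ¬? (g ≟ v)) {x} {xs} (All.lookup x∉ v∈) =
    cong suc (length-without v u v∈)

leave-sym : ∀ {n} {H : ThreeGraph n} {x y} → LeaveEdge H x y → LeaveEdge H y x
leave-sym (x≢y , uncovered) = ≢-sym x≢y , λ g g∈ (yg , xg) → uncovered g g∈ (xg , yg)

PairsInLeave : ∀ {n} → ThreeGraph n → Triple n → Set
PairsInLeave H t = ∀ {x y} → x ≢ y → x ∈ₜ t → y ∈ₜ t → LeaveEdge H x y

triangle-in-leave : ∀ {n} {H : ThreeGraph n} {t : Triple n} {p q r} → Spans t p q r →
  LeaveEdge H p q → LeaveEdge H p r → LeaveEdge H q r → PairsInLeave H t
triangle-in-leave {H = H} {p = p} {q} {r} (spans _ only) Lpq Lpr Lqr x≢y x∈ y∈ = pair (only x∈) (only y∈) x≢y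
  where
  pair : ∀ {x y} → OneOf x p q r → OneOf y p q r → x ≢ y → LeaveEdge H x y
  pair (inj₁ refl) (inj₁ refl) x≢x = ⊥-elim (x≢x refl)
  pair (inj₁ refl) (inj₂ (inj₁ refl)) _ = Lpq
  pair (inj₁ refl) (inj₂ (inj₂ refl)) _ = Lpr
  pair (inj₂ (inj₁ refl)) (inj₁ refl) _ = leave-sym {H = H} Lpq
  pair (inj₂ (inj₁ refl)) (inj₂ (inj₁ refl)) x≢x = ⊥-elim (x≢x refl)
  pair (inj₂ (inj₁ refl)) (inj₂ (inj₂ refl)) _ = Lqr
  pair (inj₂ (inj₂ refl)) (inj₁ refl) _ = leave-sym {H = H} Lpr
  pair (inj₂ (inj₂ refl)) (inj₂ (inj₁ refl)) _ = leave-sym {H = H} Lqr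
  pair (inj₂ (inj₂ refl)) (inj₂ (inj₂ refl)) x≢x = ⊥-elim (x≢x refl)

fresh : ∀ {n} (H : ThreeGraph n) {t : Triple n} → PairsInLeave H t → All (t ≢_) (edges H)
fresh H {t} inLeave = All.tabulate λ { g∈ refl →
  proj₂ (inLeave (Fin.<⇒≢ (a<b t)) (inj₁ refl) (inj₂ (inj₁ refl))) _ g∈ (inj₁ refl , inj₂ (inj₁ refl)) }

free1⇒free2 : ∀ {n} → Achieves1 n ⊆ Achieves2 n
free1⇒free2 (H , free1 , size) = H , (λ i j _ _ bad _ → ⊥-elim (free1 i j bad)) , size

-- adding two new triples with all pairs in the leave of a packing creates
-- exactly one bad pair, namely the two new triples
add-two : ∀ {n} (H : ThreeGraph n) {t₁ t₂ : Triple n} → IsPacking H → t₁ ≢ t₂ →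
  PairsInLeave H t₁ → PairsInLeave H t₂ → Achieves2 n (numEdges H + 2)
add-two H {t₁} {t₂} packing t₁≢t₂ L₁ L₂ = H⁺ , free2 , ℕ.+-comm 2 (numEdges H)
  where
  H⁺ : ThreeGraph _
  H⁺ = mk3G (t₁ ∷ t₂ ∷ edges H) ((t₁≢t₂ ∷ fresh H L₁) ∷ (fresh H L₂ ∷ unique H))

  only-new : ∀ i j → BadPair H⁺ i j → i ≡ fzero × j ≡ fsuc fzero
  only-new fzero fzero (() , _)
  only-new fzero (fsuc fzero) _ = refl , refl
  only-new fzero (fsuc (fsuc k)) (_ , x , y , x≢y , x₁ , y₁ , xg , yg) =
    ⊥-elim (proj₂ (L₁ x≢y x₁ y₁) _ (∈-lookup k) (xg , yg))
  only-new (fsuc fzero) fzero (() , _)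
  only-new (fsuc fzero) (fsuc fzero) (s≤s () , _)
  only-new (fsuc fzero) (fsuc (fsuc k)) (_ , x , y , x≢y , x₂ , y₂ , xg , yg) =
    ⊥-elim (proj₂ (L₂ x≢y x₂ y₂) _ (∈-lookup k) (xg , yg))
  only-new (fsuc (fsuc _)) fzero (() , _)
  only-new (fsuc (fsuc _)) (fsuc fzero) (s≤s () , _)
  only-new (fsuc (fsuc k)) (fsuc (fsuc l)) (s≤s (s≤s k<l) , x , y , x≢y , xg , yg , xh , yh) =
    ⊥-elim (Fin.<⇒≢ k<l (lookup-injective (unique H) k l
      (packing x y x≢y _ _ (∈-lookup k) (∈-lookup l) xg yg xh yh)))

  free2 : Free2 H⁺
  free2 i j k l bad₁ bad₂ with only-new i j bad₁ | only-new k l bad₂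
  ... | refl , refl | refl , refl = refl , refl

Shift : ℕ → Pred ℕ 0ℓ → Pred ℕ 0ℓ
Shift d P k = Σ ℕ λ k′ → P k′ × k ≡ k′ + d

-- with K4-e on v0 v1 v2 v3 in the leave, add the blocks {v0,v1,v2} and {v0,v1,v3}
packing⇒free2 : ∀ {n} → Shift 2 (AchievesM n) ⊆ Achieves2 n
packing⇒free2 (_ , (H , packing , (v₀ , v₁ , v₂ , v₃ , v₂≢v₃ , L₀₁ , L₀₂ , L₀₃ , L₁₂ , L₁₃) , refl) , refl)
  with span (proj₁ L₀₁) (proj₁ L₀₂) (proj₁ L₁₂) | span (proj₁ L₀₁) (proj₁ L₀₃) (proj₁ L₁₃)
... | t₁ , spans₁ | t₂ , spans₂ =
  add-two H packing t₁≢t₂ (triangle-in-leave {H = H} spans₁ L₀₁ L₀₂ L₁₂)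
    (triangle-in-leave {H = H} spans₂ L₀₁ L₀₃ L₁₃)
  where
  -- v₂ ∈ t₁, while the points of t₂ are v₀ v₁ v₃, all distinct from v₂
  t₁≢t₂ : t₁ ≢ t₂
  t₁≢t₂ refl with Spans.only spans₂ (proj₂ (proj₂ (Spans.contains spans₁)))
  ... | inj₁ v₂≡v₀ = proj₁ L₀₂ (sym v₂≡v₀)
  ... | inj₂ (inj₁ v₂≡v₁) = proj₁ L₁₂ (sym v₂≡v₁)
  ... | inj₂ (inj₂ v₂≡v₃) = v₂≢v₃ v₂≡v₃

-- deleting both edges e, f of the unique bad pair of H gives a packing H⁻
-- whose leave contains the K4-e formed by the pairs of e and of f
module DeleteBadPair {n} (H : ThreeGraph n) (free2 : Free2 H) {i j} (bad : BadPair H i j) where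

  open Deletion (_≟ₜ_ {n})

  e f : Triple n
  e = lookup (edges H) i
  f = lookup (edges H) j

  e≢f : e ≢ f
  e≢f e≡f = Fin.<⇒≢ (proj₁ bad) (lookup-injective (unique H) i j e≡f)

  only-pair : ∀ {g h} → g ∈ edges H → h ∈ edges H → g ≢ h → Share2 g h → g ≡ e ⊎ g ≡ f
  only-pair {g} {h} g∈ h∈ g≢h share with ordered-positions g∈ h∈ g≢h
  ... | k , l , k<l , inj₁ (k↦g , l↦h)
    with free2 k l i j (k<l , subst₂ Share2 (sym k↦g) (sym l↦h) share) bad
  ...   | refl , refl = inj₁ (sym k↦g)
  only-pair {g} {h} g∈ h∈ g≢h share | k , l , k<l , inj₂ (k↦h , l↦g)
    with free2 k l i j (k<l , subst₂ Share2 (sym k↦h) (sym l↦g) (share2-sym {e = g} {f = h} share)) bad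
  ...   | refl , refl = inj₂ (sym l↦g)

  H⁻ : ThreeGraph n
  H⁻ = mk3G (edges H without e without f) (without-unique f (without-unique e (unique H)))

  remaining : ∀ {g} → g ∈ edges H⁻ → g ∈ edges H × ¬ (g ≡ e ⊎ g ≡ f)
  remaining g∈ with without-⊆ (edges H without e) f g∈
  ... | g∈′ , g≢f with without-⊆ (edges H) e g∈′
  ...   | g∈H , g≢e = g∈H , [ g≢e , g≢f ]′

  size : numEdges H ≡ numEdges H⁻ + 2
  size = begin
    numEdges H                        ≡⟨ length-without e (unique H) (∈-lookup i) ⟩
    suc (length (edges H without e))  ≡⟨ cong suc (length-without f (without-unique e (unique H)) f∈) ⟩
    suc (suc (numEdges H⁻))           ≡⟨ ℕ.+-comm 2 (numEdges H⁻) ⟩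
    numEdges H⁻ + 2                   ∎
    where
    open ≡-Reasoning
    f∈ : f ∈ edges H without e
    f∈ = without-keeps e (∈-lookup {xs = edges H} j) (≢-sym e≢f)

  -- distinct remaining edges cannot share a pair, as only e and f do in H
  packing : IsPacking H⁻
  packing x y x≢y g h g∈ h∈ xg yg xh yh with g ≟ₜ h
  ... | yes g≡h = g≡h
  ... | no g≢h = ⊥-elim (proj₂ (remaining g∈)
    (only-pair (proj₁ (remaining g∈)) (proj₁ (remaining h∈)) g≢h (x , y , x≢y , xg , yg , xh , yh)))

  pairs-in-leave : ∀ {t} → t ∈ edges H → t ≡ e ⊎ t ≡ f → PairsInLeave H⁻ t
  pairs-in-leave {t} t∈ t∈ef x≢y xt yt = x≢y , λ g g∈ (xg , yg) →
    proj₂ (remaining g∈) (only-pair (proj₁ (remaining g∈)) t∈ (g≢t g∈) (_ , _ , x≢y , xg , yg , xt , yt))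
    where
    g≢t : ∀ {g} → g ∈ edges H⁻ → g ≢ t
    g≢t g∈ g≡t = proj₂ (remaining g∈) (Sum.map (trans g≡t) (trans g≡t) t∈ef)

  -- with e ∩ f = {x, y}, e = {x, y, z}, f = {x, y, w}: K4-e on x y z w, missing zw
  K4-e : LeaveHasK4-e H⁻
  K4-e with proj₂ bad
  ... | x , y , x≢y , xe , ye , xf , yf with third e x≢y xe ye | third f x≢y xf yf
  ...   | z , ze , z≢x , z≢y | w , wf , w≢x , w≢y =
    x , y , z , w , z≢w ,
    Le x≢y xe ye , Le (≢-sym z≢x) xe ze , Lf (≢-sym w≢x) xf wf ,
    Le (≢-sym z≢y) ye ze , Lf (≢-sym w≢y) yf wf
    where
    Le : PairsInLeave H⁻ e
    Le = pairs-in-leave (∈-lookup i) (inj₁ refl)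
    Lf : PairsInLeave H⁻ f
    Lf = pairs-in-leave (∈-lookup j) (inj₂ refl)
    z≢w : z ≢ w
    z≢w refl = e≢f (three-points-determine e f x≢y (≢-sym z≢x) (≢-sym z≢y) xe ye ze xf yf wf)

free2-split : ∀ {n} → Achieves2 n ⊆ Achieves1 n ∪ Shift 2 (AchievesM n)
free2-split (H , free2 , refl) with hasBadPair? H
... | no none = inj₁ (H , (λ i j bad → none (i , j , bad)) , refl)
... | yes (_ , _ , bad) = inj₂ (numEdges H⁻ , (H⁻ , packing , K4-e , refl) , size)
  where open DeleteBadPair H free2 bad

max-shift : ∀ {P : Pred ℕ 0ℓ} {m} d → IsMax P m → IsMax (Shift d P) (m + d)
max-shift d (Pm , maxP) = (_ , Pm , refl) , λ { _ (k , Pk , refl) → ℕ.+-monoˡ-≤ d (maxP k Pk) }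

max-unique : ∀ {P R : Pred ℕ 0ℓ} {p r} → IsMax P p → IsMax R r → P ⊆ R → R ⊆ P → r ≡ p
max-unique (Pp , maxP) (Rr , maxR) P⊆R R⊆P = ℕ.≤-antisym (maxP _ (R⊆P Rr)) (maxR _ (P⊆R Pp))

max-union : ∀ {P Q R : Pred ℕ 0ℓ} {p q r} → IsMax P p → IsMax Q q → IsMax R r →
  P ⊆ R → Q ⊆ R → R ⊆ P ∪ Q → r ≡ p ⊔ q
max-union {p = p} {q} (Pp , maxP) (Qq , maxQ) (Rr , maxR) P⊆R Q⊆R R⊆P∪Q =
  ℕ.≤-antisym
    ([ (λ Pr → ℕ.m≤n⇒m≤n⊔o q (maxP _ Pr)) , (λ Qr → ℕ.m≤n⇒m≤o⊔n p (maxQ _ Qr)) ]′ (R⊆P∪Q Rr))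
    (ℕ.⊔-lub (maxR _ (P⊆R Pp)) (maxR _ (Q⊆R Qq)))

corollary3p2 : ∀ (n t1 t2 : ℕ) → IsT1 n t1 → IsT2 n t2 →
    (∀ m → IsM n m → t2 ≡ t1 ⊔ (m + 2)) × (¬ (∃ λ k → AchievesM n k) → t2 ≡ t1)
corollary3p2 n t1 t2 maxT1 maxT2 =
  (λ m maxM → max-union maxT1 (max-shift 2 maxM) maxT2 free1⇒free2 packing⇒free2 free2-split) ,
  (λ noPacking → max-unique maxT1 maxT2 free1⇒free2 (only-free1 noPacking))
  where
  only-free1 : ¬ (∃ λ k → AchievesM n k) → Achieves2 n ⊆ Achieves1 n
  only-free1 noPacking A2 =
    [ id , (λ { (k , AM , _) → ⊥-elim (noPacking (k , AM)) }) ]′ (free2-split A2)
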